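{- Let $G=(V,E,w)$ be a graph with non-negative edge-weights, $s\in V$ and $t\ge 0$. If $\mathtt{HBD}(G,s,t)$ does not detect a cycle, then for every $v\in B_G(s,t)$ there exists a unique $sv$-path in $G$ of weight at most $t$.
   Context: Graphs are finite, simple, connected and undirected; paths are simple. $dist(u,v)$ is the minimum weight of a $uv$-path and $B_G(s,t)=\{u : dist(s,u)\le t\}$. The procedure $\mathtt{HBD}(G,s,t)$ is the following truncated Dijkstra search: set $d(v)=\infty$ for all $v$, $d(s)=0$, and a priority queue $Q=\{s\}$. While $Q\ne\emptyset$, extract $u\in Q$ with minimum $d(u)$ and scan the edges $uv$ incident to $u$ (other than the edge through which $u$ was discovered) in non-decreasing order of weight as long as $d(u)+w_{uv}\le t$; for each such edge ("relaxing" $uv$): if $d(v)\neq\infty$, report a cycle (formed by $uv$ and the search-tree paths from $s$ to $u$ and to $v$) and stop; otherwise set $d(v)=d(u)+w_{uv}$ and insert $v$ into $Q$. The procedure "detects a cycle" if it stops by reporting a cycle.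
   Formalization: The edge weights and the threshold $t$ are rational rather than real. -}

module Defs where

open import Data.Nat using (ℕ)
open import Data.Unit using (⊤)
open import Data.Fin using (Fin; _≟_)
open import Data.Rational using (ℚ; 0ℚ; _+_; _≤_; _<_)
open import Data.Bool using (Bool; true; false; if_then_else_)
open import Data.Maybe using (Maybe; just; nothing)
open import Data.List using (List; []; _∷_; head; last)
open import Data.List.Membership.Propositional using (_∈_)
open import Data.List.Relation.Unary.Unique.Propositional using (Unique)
open import Data.List.Relation.Unary.Linked using (Linked)
open import Data.Product using (Σ; ∃; _×_; _,_)
open import Relation.Binary.PropositionalEquality using (_≡_; _≢_)
open import Relation.Binary.Construct.Closure.ReflexiveTransitive using (Star)
open import Relation.Nullary.Decidable using (⌊_⌋)
open import Function.Bundles using (_⇔_)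

-- Finite simple connected undirected graphs on vertex set Fin n,
-- with rational edge weights (weights only matter on edges).

Adjacent : {n : ℕ} → (Fin n → Fin n → Bool) → List (Fin n) → Set
Adjacent adj []           = ⊤
Adjacent adj (x ∷ [])     = ⊤
Adjacent adj (x ∷ y ∷ r)  = (adj x y ≡ true) × Adjacent adj (y ∷ r)

IsPathIn : {n : ℕ} → (Fin n → Fin n → Bool) → Fin n → Fin n → List (Fin n) → Set
IsPathIn adj a b p = (head p ≡ just a) × (last p ≡ just b) × Adjacent adj p × Unique p

record Graph (n : ℕ) : Set where
  field
    adj       : Fin n → Fin n → Bool
    w         : Fin n → Fin n → ℚ
    adj-sym   : ∀ u v → adj u v ≡ adj v u
    adj-irr   : ∀ u → adj u u ≡ false
    w-sym     : ∀ u v → w u v ≡ w v u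
    connected : ∀ u v → ∃ λ p → IsPathIn adj u v p

module _ {n : ℕ} (G : Graph n) where
  open Graph G

  V : Set
  V = Fin n

  IsPath : V → V → List V → Set
  IsPath = IsPathIn adj

  weight : List V → ℚ
  weight (x ∷ y ∷ r) = w x y + weight (y ∷ r)
  weight _           = 0ℚ

  NonNegWeights : Set
  NonNegWeights = ∀ u v → adj u v ≡ true → 0ℚ ≤ w u v

  IsDist : V → V → ℚ → Set
  IsDist u v d = (∃ λ p → IsPath u v p × weight p ≡ d)
               × (∀ p → IsPath u v p → d ≤ weight p)

  InBall : V → ℚ → V → Set
  InBall s t u = ∃ λ d → IsDist s u d × d ≤ t

  -- The procedure HBD(G,s,t), as a nondeterministic small-step
  -- transition system (ties in the priority queue and among equal
  -- weights may be broken arbitrarily).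

  upd : {A : Set} → (V → A) → V → A → V → A
  upd f x a y = if ⌊ x ≟ y ⌋ then a else f y

  data Phase : Set where
    idle     : Phase
    -- scanning the remaining (sorted) edges of u, where d(u) = du
    scanning : (u : V) (du : ℚ) (rest : List V) → Phase

  record State : Set where
    constructor st
    field
      d     : V → Maybe ℚ        -- nothing = ∞
      par   : V → Maybe V        -- vertex through which v was discovered
      inQ   : V → Bool           -- membership in the priority queue Q
      phase : Phase

  data Config : Set where
    running : State → Config
    cycle   : Config
    done    : State → Config

  initial : V → Config
  initial s = running (st (upd (λ _ → nothing) s (just 0ℚ))
                          (λ _ → nothing)
                          (upd (λ _ → false) s true)
                          idle)

  ScanOrder : V → Maybe V → List V → Set
  ScanOrder u pu L = Unique L
                   × (∀ v → (v ∈ L) ⇔ ((adj u v ≡ true) × (pu ≢ just v)))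
                   × Linked (λ x y → w u x ≤ w u y) L

  data Step (t : ℚ) : Config → Config → Set where
    finish  : ∀ d par inQ → (∀ v → inQ v ≡ false) →
              Step t (running (st d par inQ idle)) (done (st d par inQ idle))
    extract : ∀ d par inQ u du L →
              inQ u ≡ true → d u ≡ just du →
              (∀ x → inQ x ≡ true → Σ ℚ λ dx → (d x ≡ just dx) × (du ≤ dx)) →
              ScanOrder u (par u) L →
              Step t (running (st d par inQ idle))
                     (running (st d par (upd inQ u false) (scanning u du L)))
    scan-end  : ∀ d par inQ u du →
              Step t (running (st d par inQ (scanning u du [])))
                     (running (st d par inQ idle))
    scan-stop : ∀ d par inQ u du v rest → t < du + w u v →
              Step t (running (st d par inQ (scanning u du (v ∷ rest))))
                     (running (st d par inQ idle))
    relax-cycle : ∀ d par inQ u du v rest dv → du + w u v ≤ t → d v ≡ just dv →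
              Step t (running (st d par inQ (scanning u du (v ∷ rest)))) cycle
    relax-new : ∀ d par inQ u du v rest → du + w u v ≤ t → d v ≡ nothing →
              Step t (running (st d par inQ (scanning u du (v ∷ rest))))
                     (running (st (upd d v (just (du + w u v)))
                                  (upd par v (just u))
                                  (upd inQ v true)
                                  (scanning u du rest)))

  -- HBD(G,s,t) terminates without detecting a cycle (along some run
  -- consistent with the procedure, ending in final state σ)
  HBDNoCycle : V → ℚ → Set
  HBDNoCycle s t = ∃ λ σ → Star (Step t) (initial s) (done σ)

module Submission where

-- Fix any path P = s … v of weight at most t.  We follow a run of
-- HBD that ends without reporting a cycle and show that the search tree
-- swallows P edge by edge: at every moment P splits as a prefix s … x that
-- is already a parent chain of the search tree, followed by a pending
-- suffix x b …, where x still has to relax the edge xb (x waits in the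
-- queue, or x is being scanned with b ahead in its sorted edge list).
-- Because weights are non-negative, d(x) + w(xb) ≤ d(x) + weight(x b …) ≤ t,
-- so the scan of x cannot stop before reaching b, and when xb is relaxed b
-- must still be undiscovered (otherwise a cycle would be reported); b then
-- joins the tree with parent x.  Hence in the final state the reversed
-- path P is the parent chain from v.  Since a vertex has only one parent
-- chain, two such paths to v coincide.

open import Defs
open import Data.Nat using (ℕ)
open import Data.Fin using (Fin; _≟_)
open import Data.Rational using (ℚ; 0ℚ; _≤_; _<_; _+_)
import Data.Rational.Properties as ℚ
open import Data.List using (List; []; _∷_; head; last; _ʳ++_)
open import Data.List.Membership.Propositional using (_∈_)
import Data.List.Relation.Unary.Any as Any
import Data.List.Relation.Unary.All as All
open All using (_∷_)
open import Data.List.Relation.Unary.Unique.Propositional using (Unique)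
open import Data.List.Relation.Unary.AllPairs using (_∷_)
open import Data.List.Relation.Unary.Linked as Linked using (Linked)
open import Data.List.Relation.Unary.Linked.Properties using (Linked⇒All)
open import Data.Product using (∃; _×_; _,_; proj₁; proj₂)
open import Data.Sum using (_⊎_; inj₁; inj₂)
open import Data.Bool using (Bool; true; false)
open import Data.Maybe using (Maybe; just; nothing)
open import Data.Maybe.Properties using (just-injective)
open import Data.Empty using (⊥; ⊥-elim)
open import Data.Unit using (⊤; tt)
open import Relation.Binary.PropositionalEquality using (_≡_; refl; sym; trans; subst; cong; _≢_)
open import Relation.Binary.Construct.Closure.ReflexiveTransitive using (Star; ε; _◅_)
open import Relation.Nullary using (yes; no)
open import Function.Bundles using (Equivalence)

last-ʳ++ : ∀ {A : Set} (R : List A) (x : A) (S : List A) → last (R ʳ++ x ∷ S) ≡ last (x ∷ S)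
last-ʳ++ []      x S = refl
last-ʳ++ (y ∷ R) x S = last-ʳ++ R y (x ∷ S)

starts-with : ∀ {A : Set} (xs : List A) {x : A} → head xs ≡ just x → ∃ λ ys → xs ≡ x ∷ ys
starts-with (x ∷ ys) refl = ys , refl

≤-+-nonNeg : ∀ p {q} → 0ℚ ≤ q → p ≤ p + q
≤-+-nonNeg p {q} 0≤q = subst (_≤ p + q) (ℚ.+-identityʳ p) (ℚ.+-monoʳ-≤ p 0≤q)

sorted-first-least : ∀ {A : Set} (f : A → ℚ) {v b : A} {rest : List A} →
  Linked (λ x y → f x ≤ f y) (v ∷ rest) → b ∈ v ∷ rest → f v ≤ f b
sorted-first-least f sorted b∈ = All.lookup (Linked⇒All (λ p q → ℚ.≤-trans p q) ℚ.≤-refl sorted) b∈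

module SearchTree {n : ℕ} (G : Graph n) where
  open Graph G

  upd-same : ∀ {A : Set} (f : Fin n → A) x a → upd G f x a x ≡ a
  upd-same f x a with x ≟ x
  ... | yes _   = refl
  ... | no x≢x = ⊥-elim (x≢x refl)

  upd-other : ∀ {A : Set} (f : Fin n → A) x a y → x ≢ y → upd G f x a y ≡ f y
  upd-other f x a y x≢y with x ≟ y
  ... | yes x≡y = ⊥-elim (x≢y x≡y)
  ... | no _    = refl

  upd-true : ∀ (f : Fin n → Bool) x y → f y ≡ true → upd G f x true y ≡ true
  upd-true f x y fy with x ≟ y
  ... | yes _ = refl
  ... | no _  = fy

  Discovered : (Fin n → Maybe ℚ) → Fin n → Set
  Discovered d y = ∃ λ c → d y ≡ just c

  ParentChain : (Fin n → Maybe ℚ) → (Fin n → Maybe (Fin n)) → List (Fin n) → Set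
  ParentChain d par []          = ⊥
  ParentChain d par (x ∷ [])    = (par x ≡ nothing) × Discovered d x
  ParentChain d par (x ∷ y ∷ R) = (par x ≡ just y) × Discovered d x × ParentChain d par (y ∷ R)

  parentChain-unique : ∀ {d par x R₁ R₂} →
    ParentChain d par (x ∷ R₁) → ParentChain d par (x ∷ R₂) → R₁ ≡ R₂
  parentChain-unique {R₁ = []}    {[]}    _ _ = refl
  parentChain-unique {R₁ = []}    {_ ∷ _} (p , _) (p′ , _) with trans (sym p) p′
  ... | ()
  parentChain-unique {R₁ = _ ∷ _} {[]}    (p , _) (p′ , _) with trans (sym p) p′
  ... | ()
  parentChain-unique {R₁ = _ ∷ _} {_ ∷ _} (p , _ , c) (p′ , _ , c′) with just-injective (trans (sym p) p′)
  ... | refl = cong (_ ∷_) (parentChain-unique c c′)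

  Extends : (d d′ : Fin n → Maybe ℚ) (par par′ : Fin n → Maybe (Fin n)) → Set
  Extends d d′ par par′ = ∀ y c → d y ≡ just c → (d′ y ≡ just c) × (par′ y ≡ par y)

  extends-chain : ∀ {d d′ par par′} → Extends d d′ par par′ →
    ∀ R → ParentChain d par R → ParentChain d′ par′ R
  extends-chain ext (x ∷ [])    (p , (c , dx)) = trans (proj₂ (ext x c dx)) p , (c , proj₁ (ext x c dx))
  extends-chain ext (x ∷ y ∷ R) (p , (c , dx) , chain) =
    trans (proj₂ (ext x c dx)) p , (c , proj₁ (ext x c dx)) , extends-chain ext (y ∷ R) chain

  discover-extends : ∀ d par v a b → d v ≡ nothing → Extends d (upd G d v a) par (upd G par v b)
  discover-extends d par v a b dv y c dy = trans (upd-other d v a y v≢y) dy , upd-other par v b y v≢y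
    where
    v≢y : v ≢ y
    v≢y refl with trans (sym dv) dy
    ... | ()

module Tracing {n : ℕ} (G : Graph n) (nonNeg : NonNegWeights G) (t : ℚ) (P : List (Fin n)) where
  open Graph G
  open SearchTree G
  open State

  weight-nonNeg : ∀ L → Adjacent adj L → 0ℚ ≤ weight G L
  weight-nonNeg []          _          = ℚ.≤-refl
  weight-nonNeg (x ∷ [])    _          = ℚ.≤-refl
  weight-nonNeg (x ∷ y ∷ R) (xy , adjR) =
    subst (_≤ w x y + weight G (y ∷ R)) (ℚ.+-identityʳ 0ℚ) (ℚ.+-mono-≤ (nonNeg x y xy) (weight-nonNeg (y ∷ R) adjR))

  ByWeight : Fin n → Fin n → Fin n → Set
  ByWeight x a b = w x a ≤ w x b

  -- x still has to relax xb: it waits in Q, or is being scanned with b ahead.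
  WillRelax : State G → Fin n → ℚ → Fin n → Set
  WillRelax σ x dx b = (inQ σ x ≡ true)
    ⊎ ∃ λ rest → (phase σ ≡ scanning x dx rest) × (b ∈ rest) × Linked (ByWeight x) rest

  record PendingEdge (σ : State G) (x b : Fin n) (S : List (Fin n)) : Set where
    field
      label         : ℚ
      labelled      : d σ x ≡ just label
      within-budget : label + weight G (x ∷ b ∷ S) ≤ t
      adjacent      : Adjacent adj (x ∷ b ∷ S)
      unique        : Unique (x ∷ b ∷ S)
      not-parent    : par σ x ≢ just b
      will-relax    : WillRelax σ x label b

  Frontier : State G → Fin n → List (Fin n) → Set
  Frontier σ x []      = ⊤
  Frontier σ x (b ∷ S) = PendingEdge σ x b S

  record Invariant (σ : State G) : Set where
    field
      reached   : Fin n
      back      : List (Fin n)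
      remaining : List (Fin n)
      split     : P ≡ (reached ∷ back) ʳ++ remaining
      in-tree   : ParentChain (d σ) (par σ) (reached ∷ back)
      frontier  : Frontier σ reached remaining

  Traced : State G → Set
  Traced σ = ∃ λ x → ∃ λ R → (P ≡ (x ∷ R) ʳ++ []) × ParentChain (d σ) (par σ) (x ∷ R)

  ConfigInvariant : Config G → Set
  ConfigInvariant (running σ) = Invariant σ
  ConfigInvariant cycle       = ⊤
  ConfigInvariant (done σ)    = Traced σ

  earlier-edge-fits : ∀ {x dx b S v rest} → dx + weight G (x ∷ b ∷ S) ≤ t → Adjacent adj (x ∷ b ∷ S) →
    Linked (ByWeight x) (v ∷ rest) → b ∈ v ∷ rest → dx + w x v ≤ t
  earlier-edge-fits {x} {dx} {b} {S} {v} budget (_ , adjS) sorted b∈ = begin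
    dx + w x v                    ≤⟨ ℚ.+-monoʳ-≤ dx (sorted-first-least (w x) sorted b∈) ⟩
    dx + w x b                    ≤⟨ ℚ.+-monoʳ-≤ dx (≤-+-nonNeg (w x b) (weight-nonNeg (b ∷ S) adjS)) ⟩
    dx + weight G (x ∷ b ∷ S)     ≤⟨ budget ⟩
    t                             ∎
    where open ℚ.≤-Reasoning

  carry : ∀ {d d′ par par′ inQ inQ′ ph ph′ x b S} → Extends d d′ par par′ →
    (e : PendingEdge (st d par inQ ph) x b S) → WillRelax (st d′ par′ inQ′ ph′) x (PendingEdge.label e) b →
    PendingEdge (st d′ par′ inQ′ ph′) x b S
  carry ext e r = record
    { label = label ; labelled = proj₁ (ext _ label labelled) ; within-budget = within-budget
    ; adjacent = adjacent ; unique = unique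
    ; not-parent = λ par′x≡b → not-parent (trans (sym (proj₂ (ext _ label labelled))) par′x≡b)
    ; will-relax = r }
    where open PendingEdge e

  unchanged : ∀ {d par} → Extends d d par par
  unchanged _ _ dy = dy , refl

  -- Extracting u: a waiting x stays in Q unless x = u, in which case b is in u's scan list.
  extract-frontier : ∀ {d par inQ u du L} x S → d u ≡ just du → ScanOrder G u (par u) L →
    Frontier (st d par inQ idle) x S → Frontier (st d par (upd G inQ u false) (scanning u du L)) x S
  extract-frontier x []      _ _ _ = tt
  extract-frontier x (b ∷ S) _ _ record { will-relax = inj₂ (_ , () , _) }
  extract-frontier {inQ = inQ} {u} {L = L} x (b ∷ S) du≡ (_ , edges , sorted) e@record { will-relax = inj₁ x∈Q }
    with u ≟ x
  ... | no u≢x = carry unchanged e (inj₁ (trans (upd-other inQ u false x u≢x) x∈Q))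
  ... | yes refl with just-injective (trans (sym (PendingEdge.labelled e)) du≡)
  ...   | refl = carry unchanged e (inj₂ (L , refl , b∈L , sorted))
    where
    b∈L : b ∈ L
    b∈L = Equivalence.from (edges b) (proj₁ (PendingEdge.adjacent e) , PendingEdge.not-parent e)

  -- Finishing a scan: b cannot be pending in an exhausted list.
  scanEnd-frontier : ∀ {d par inQ u du} x S →
    Frontier (st d par inQ (scanning u du [])) x S → Frontier (st d par inQ idle) x S
  scanEnd-frontier x []      _ = tt
  scanEnd-frontier x (b ∷ S) e@record { will-relax = inj₁ x∈Q } = carry unchanged e (inj₁ x∈Q)
  scanEnd-frontier x (b ∷ S) record { will-relax = inj₂ (_ , refl , () , _) }

  -- Stopping a scan early: the pending edge xb would exceed t, contradicting the budget.
  scanStop-frontier : ∀ {d par inQ u du v rest} x S → t < du + w u v →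
    Frontier (st d par inQ (scanning u du (v ∷ rest))) x S → Frontier (st d par inQ idle) x S
  scanStop-frontier x []      _ _ = tt
  scanStop-frontier x (b ∷ S) _ e@record { will-relax = inj₁ x∈Q } = carry unchanged e (inj₁ x∈Q)
  scanStop-frontier {du = du} x (b ∷ S) t< e@record { will-relax = inj₂ (_ , refl , b∈ , sorted) } =
    ⊥-elim (ℚ.<-irrefl refl (ℚ.<-≤-trans t< fits))
    where
    fits = earlier-edge-fits {dx = du} (PendingEdge.within-budget e) (PendingEdge.adjacent e) sorted b∈

  enter-frontier : ∀ {σ x b dx} S → d σ b ≡ just (dx + w x b) → par σ b ≡ just x → inQ σ b ≡ true →
    dx + weight G (x ∷ b ∷ S) ≤ t → Adjacent adj (x ∷ b ∷ S) → Unique (x ∷ b ∷ S) → Frontier σ b S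
  enter-frontier []        _ _ _ _ _ _ = tt
  enter-frontier {x = x} {b} {dx} (c ∷ S) db parb b∈Q budget (_ , adjS) ((_ ∷ x≢c ∷ _) ∷ uniqS) = record
    { label = dx + w x b ; labelled = db
    ; within-budget = subst (_≤ t) (sym (ℚ.+-assoc dx (w x b) _)) budget
    ; adjacent = adjS ; unique = uniqS
    ; not-parent = λ parb≡c → x≢c (just-injective (trans (sym parb) parb≡c))
    ; will-relax = inj₁ b∈Q }

  persist : ∀ {d d′ par par′ inQ inQ′ ph ph′ x R b S} → Extends d d′ par par′ → P ≡ (x ∷ R) ʳ++ (b ∷ S) →
    ParentChain d par (x ∷ R) → (e : PendingEdge (st d par inQ ph) x b S) →
    WillRelax (st d′ par′ inQ′ ph′) x (PendingEdge.label e) b → Invariant (st d′ par′ inQ′ ph′)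
  persist ext P≡ chain e r = record
    { reached = _ ; back = _ ; remaining = _ ; split = P≡
    ; in-tree = extends-chain ext _ chain ; frontier = carry ext e r }

  -- Relaxing uv for an undiscovered v: the traced prefix stays in the tree, and
  -- if uv is the pending edge of P then v joins the traced prefix.
  relax-invariant : ∀ {d par inQ u du v rest} → d v ≡ nothing →
    Invariant (st d par inQ (scanning u du (v ∷ rest))) →
    Invariant (st (upd G d v (just (du + w u v))) (upd G par v (just u)) (upd G inQ v true) (scanning u du rest))
  relax-invariant {d} {par} {inQ} {u} {du} {v} dv
    record { reached = x ; back = R ; remaining = [] ; split = P≡ ; in-tree = chain } =
    record { reached = x ; back = R ; remaining = [] ; split = P≡
           ; in-tree = extends-chain (discover-extends d par v _ _ dv) _ chain ; frontier = tt }
  relax-invariant {d} {par} {inQ} {u} {du} {v} dv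
    record { reached = x ; back = R ; remaining = b ∷ S ; split = P≡ ; in-tree = chain ; frontier = e }
    with PendingEdge.will-relax e
  ... | inj₁ x∈Q =
    persist (discover-extends d par v _ _ dv) P≡ chain e (inj₁ (upd-true inQ v x x∈Q))
  ... | inj₂ (rest′ , refl , b∈ , sorted) with v ≟ b
  ...   | no v≢b =
    persist (discover-extends d par v _ _ dv) P≡ chain e
      (inj₂ (_ , refl , Any.tail (λ b≡v → v≢b (sym b≡v)) b∈ , Linked.tail sorted))
  ...   | yes refl = record
    { reached = v ; back = x ∷ R ; remaining = S ; split = P≡
    ; in-tree = upd-same par v (just x) , (_ , upd-same d v _) , extends-chain (discover-extends d par v _ _ dv) _ chain
    ; frontier = enter-frontier {dx = du} S (upd-same d v _) (upd-same par v _) (upd-same inQ v true)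
                   within-budget adjacent unique }
    where open PendingEdge e

  reframe : ∀ {d par inQ inQ′ ph ph′} (I : Invariant (st d par inQ ph)) →
    Frontier (st d par inQ′ ph′) (Invariant.reached I) (Invariant.remaining I) → Invariant (st d par inQ′ ph′)
  reframe I f = record
    { reached = reached ; back = back ; remaining = remaining ; split = split ; in-tree = in-tree ; frontier = f }
    where open Invariant I

  -- When Q is empty and no vertex is being scanned, nothing of P can be pending.
  finish-traced : ∀ {d par inQ} → (∀ v → inQ v ≡ false) → Invariant (st d par inQ idle) → Traced (st d par inQ idle)
  finish-traced _ record { remaining = [] ; split = P≡ ; in-tree = chain } = _ , _ , P≡ , chain
  finish-traced allOut record { reached = x ; remaining = _ ∷ _ ; frontier = record { will-relax = inj₁ x∈Q } }
    with trans (sym x∈Q) (allOut x)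
  ... | ()
  finish-traced _ record { remaining = _ ∷ _ ; frontier = record { will-relax = inj₂ (_ , () , _) } }

  step-preserves : ∀ {c c′} → ConfigInvariant c → Step G t c c′ → ConfigInvariant c′
  step-preserves I (finish _ _ _ allOut)                  = finish-traced allOut I
  step-preserves I (extract _ _ _ _ _ _ _ du≡ _ order)    = reframe I (extract-frontier _ _ du≡ order (Invariant.frontier I))
  step-preserves I (scan-end _ _ _ _ _)                   = reframe I (scanEnd-frontier _ _ (Invariant.frontier I))
  step-preserves I (scan-stop _ _ _ _ _ _ _ t<)           = reframe I (scanStop-frontier _ _ t< (Invariant.frontier I))
  step-preserves I (relax-cycle _ _ _ _ _ _ _ _ _ _)      = tt
  step-preserves I (relax-new _ _ _ _ _ _ _ _ dv)         = relax-invariant dv I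

  preserved : ∀ {c c′} → ConfigInvariant c → Star (Step G t) c c′ → ConfigInvariant c′
  preserved I ε          = I
  preserved I (s ◅ run)  = preserved (step-preserves I s) run

  -- Initially only s is in the tree; the pending part of P is everything after s.
  initial-invariant : ∀ {s} → head P ≡ just s → Adjacent adj P → Unique P → weight G P ≤ t →
    ConfigInvariant (initial G s)
  initial-invariant {s} P-head adjP uniqP light with starts-with P P-head
  ... | S , P≡ = record
    { reached = s ; back = [] ; remaining = S ; split = P≡
    ; in-tree = refl , (0ℚ , upd-same _ s _)
    ; frontier = start S (subst (Adjacent adj) P≡ adjP) (subst Unique P≡ uniqP) (subst (λ L → weight G L ≤ t) P≡ light) }
    where
    start : ∀ S → Adjacent adj (s ∷ S) → Unique (s ∷ S) → weight G (s ∷ S) ≤ t →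
      Frontier (st (upd G (λ _ → nothing) s (just 0ℚ)) (λ _ → nothing) (upd G (λ _ → false) s true) idle) s S
    start []      _ _ _ = tt
    start (b ∷ S) adjS uniqS lightS = record
      { label = 0ℚ ; labelled = upd-same _ s _
      ; within-budget = subst (_≤ t) (sym (ℚ.+-identityˡ _)) lightS
      ; adjacent = adjS ; unique = uniqS ; not-parent = λ () ; will-relax = inj₁ (upd-same _ s true) }

  traced-endpoint : ∀ {x R v} → P ≡ (x ∷ R) ʳ++ [] → last P ≡ just v → x ≡ v
  traced-endpoint {x} {R} P≡ P-last = just-injective (trans (sym (trans (cong last P≡) (last-ʳ++ R x []))) P-last)

  traced-by-search : ∀ {s v σ} → Star (Step G t) (initial G s) (done σ) →
    IsPath G s v P → weight G P ≤ t → ∃ λ R → (P ≡ (v ∷ R) ʳ++ []) × ParentChain (d σ) (par σ) (v ∷ R)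
  traced-by-search run (P-head , P-last , adjP , uniqP) light
    with preserved (initial-invariant P-head adjP uniqP light) run
  ... | x , R , P≡ , chain with traced-endpoint {x} {R} P≡ P-last
  ...   | refl = R , P≡ , chain

open SearchTree using (parentChain-unique)
open Tracing using (traced-by-search)

lemma5 : ∀ {n : ℕ} (G : Graph n) → NonNegWeights G → (s : Fin n) (t : ℚ) → 0ℚ ≤ t →
           HBDNoCycle G s t →
           ∀ v → InBall G s t v →
           ∃ λ (p : List (Fin n)) → (IsPath G s v p × weight G p ≤ t)
             × (∀ q → IsPath G s v q → weight G q ≤ t → q ≡ p)
lemma5 G nonNeg s t _ (σ , run) v (δ , ((p , p-path , p-weight) , _) , δ≤t) = p , (p-path , p-light) , unique
  where
  p-light : weight G p ≤ t
  p-light = subst (_≤ t) (sym p-weight) δ≤t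

  -- Both p and q are the reversed parent chain of v in the final search tree.
  unique : ∀ q → IsPath G s v q → weight G q ≤ t → q ≡ p
  unique q q-path q-light
    with traced-by-search G nonNeg t p run p-path p-light | traced-by-search G nonNeg t q run q-path q-light
  ... | Rp , p≡ , p-chain | Rq , q≡ , q-chain with parentChain-unique G q-chain p-chain
  ...   | refl = trans q≡ (sym p≡)
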